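{- Let $S\subseteq\mathbb N$ be a numerical semigroup of genus $g\ge 2$, and let $G=\mathbb N\setminus S$. Then the Buchweitz set $$\mathrm{B}(S)=\{n\ge 2 \mid |nG| > (2n-1)(|G|-1)\}$$ is finite.
   Context: $\mathbb N=\{0,1,2,\dots\}$. A numerical semigroup is a subset $S\subseteq\mathbb N$ containing $0$, closed under addition, with finite complement $\mathbb N\setminus S$ (the gapset); its genus is $|\mathbb N\setminus S|$. For a finite set $A\subset\mathbb Z$ and $n\ge1$, $nA$ is the $n$-fold sumset: $1A=A$, $nA=A+(n-1)A$, where $X+Y=\{x+y\mid x\in X, y\in Y\}$. -}

module Defs where

open import Data.Nat using (ℕ; zero; suc; _+_; _*_; _∸_; _≤_; _<_)
open import Data.Nat.Properties using (_≟_)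
open import Data.Bool using (Bool; true; false; not)
open import Data.List using (List; []; _∷_; map; concatMap; filter; length; upTo; deduplicate)
open import Data.Product using (∃; _×_)
open import Relation.Binary.PropositionalEquality using (_≡_)
open import Relation.Nullary using (¬_)
open import Relation.Nullary.Decidable using (_×-dec_)
open import Data.Bool using (T?)

-- S is a numerical semigroup: contains 0 and closed under addition.
-- (Finite complement is a separate hypothesis carrying an explicit bound.)
record IsSubmonoid (S : ℕ → Bool) : Set where
  field
    zero∈ : S 0 ≡ true
    closed : ∀ a b → S a ≡ true → S b ≡ true → S (a + b) ≡ true

CofiniteBound : (S : ℕ → Bool) → ℕ → Set
CofiniteBound S F = ∀ n → F ≤ n → S n ≡ true

-- The gapset ℕ \ S, listed (without repetitions) as the elements < F not in S.
-- For any cofinite bound F this is exactly the gapset.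
gapset : (S : ℕ → Bool) → ℕ → List ℕ
gapset S F = filter (λ n → T? (not (S n))) (upTo F)

sumset : List ℕ → List ℕ → List ℕ
sumset X Y = deduplicate _≟_ (concatMap (λ x → map (x +_) Y) X)

-- n-fold sumset: 1A = A, nA = A + (n-1)A  (0A := {0}, never used).
nfold : ℕ → List ℕ → List ℕ
nfold zero A = 0 ∷ []
nfold (suc zero) A = A
nfold (suc (suc n)) A = sumset A (nfold (suc n) A)

InBuchweitz : List ℕ → ℕ → Set
InBuchweitz G n = 2 ≤ n × ((2 * n ∸ 1) * (length G ∸ 1) < length (nfold n G))

FiniteSet : (ℕ → Set) → Set
FiniteSet P = ∃ λ N → ∀ n → N ≤ n → ¬ P n

-- Let f be the Frobenius number, g the genus, and n ≥ 2. Every element of nG lies in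
-- [n, nf], so y ↦ nf − y maps nG injectively into [0, n(f − 1)]; moreover every z ≤ f
-- is a gap or f − z is one, whence f + 1 ≤ 2g. If S is symmetric (f − x ∈ S for all
-- gaps x), the image lies in S, which misses the g gaps in [0, n(f − 1)], and
-- |nG| ≤ n(f − 1) + 1 − g ≤ (2n − 1)(g − 1) for every n ≥ 2. Otherwise some gap x has
-- f − x ∉ S, the pairing z ↦ f − z improves the count to f + 2 ≤ 2g, and the trivial
-- bound |nG| ≤ n(f − 1) + 1 is at most (2n − 1)(g − 1) once n ≥ g.
module Submission where

open import Defs
open import Data.Nat using (ℕ; _≤_)
open import Data.Bool using (Bool)
open import Data.List using (length)

open import Data.Nat using (zero; suc; _+_; _*_; _∸_; _<_; z≤n; s≤s; z<s)
open import Data.Nat.Properties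
open import Data.Nat.Tactic.RingSolver using (solve-∀)
open import Algebra.Properties.CommutativeSemigroup +-commutativeSemigroup using (interchange)
open import Data.Bool using (true; false; not; T; T?)
open import Data.Bool.Properties using (not-¬)
import Data.Bool as Bool
open import Data.List using (List; []; _∷_; map; filter; upTo; _++_)
open import Data.List.Properties using (length-upTo; length-++; length-map; length-filter; filter-notAll)
open import Data.List.Membership.Propositional using (_∈_)
open import Data.List.Membership.Propositional.Properties
  using (∈-filter⁺; ∈-filter⁻; ∈-upTo⁺; ∈-upTo⁻; ∈-map⁺; ∈-map⁻; ∈-++⁺ˡ; ∈-++⁺ʳ)
open import Data.List.Relation.Binary.Subset.Propositional using (_⊆_)
open import Data.List.Relation.Unary.Any as Any using (here; there)
open import Data.List.Relation.Unary.All as All using (All; []; _∷_; all?)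
import Data.List.Relation.Unary.All.Properties as All
open import Data.List.Relation.Unary.Unique.Propositional using (Unique; []; _∷_)
import Data.List.Relation.Unary.Unique.Propositional.Properties as Unique
import Data.List.Relation.Unary.Unique.DecPropositional.Properties as UniqueDec
open import Data.Product using (∃; _×_; _,_; proj₁; proj₂)
open import Data.Sum using (_⊎_; inj₁; inj₂)
open import Data.Empty using (⊥-elim)
open import Function using (_∘_)
open import Relation.Binary.Definitions using (DecidableEquality)
open import Relation.Unary using (Decidable)
open import Relation.Binary.PropositionalEquality
open import Relation.Nullary using (¬_; yes; no; ¬?; contradiction)

first-∈ : ∀ {A : Set} {xs : List A} → 1 ≤ length xs → ∃ (_∈ xs)
first-∈ {xs = x ∷ _} _ = x , here refl

unique⊆⇒length≤ : {A : Set} → DecidableEquality A → {xs ys : List A} →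
  Unique xs → xs ⊆ ys → length xs ≤ length ys
unique⊆⇒length≤ _≟ᴬ_ {[]} _ _ = z≤n
unique⊆⇒length≤ _≟ᴬ_ {x ∷ xs} {ys} (x∉xs ∷ xs-unique) xs⊆ys =
  ≤-trans (s≤s (unique⊆⇒length≤ _≟ᴬ_ xs-unique xs⊆ys-x))
          (filter-notAll (¬? ∘ (x ≟ᴬ_)) ys (Any.map (λ x≡y x≢y → x≢y x≡y) (xs⊆ys (here refl))))
  where
  xs⊆ys-x : xs ⊆ filter (¬? ∘ (x ≟ᴬ_)) ys
  xs⊆ys-x y∈xs = ∈-filter⁺ (¬? ∘ (x ≟ᴬ_)) (xs⊆ys (there y∈xs)) (All.lookup x∉xs y∈xs)

unique<⇒length≤ : ∀ {xs m} → Unique xs → All (_< m) xs → length xs ≤ m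
unique<⇒length≤ {xs} {m} xs-unique xs<m =
  subst (length xs ≤_) (length-upTo m)
    (unique⊆⇒length≤ _≟_ xs-unique (∈-upTo⁺ ∘ All.lookup xs<m))

unique-map-∸ : ∀ m {xs} → All (_≤ m) xs → Unique xs → Unique (map (m ∸_) xs)
unique-map-∸ m [] [] = []
unique-map-∸ m (x≤m ∷ xs≤m) (x∉xs ∷ xs-unique) =
  All.map⁺ (All.zipWith (λ (y≤m , x≢y) eq → x≢y (∸-cancelˡ-≡ x≤m y≤m eq)) (xs≤m , x∉xs))
  ∷ unique-map-∸ m xs≤m xs-unique

All-sumset : ∀ {P Q R : ℕ → Set} {X Y} → (∀ {x y} → P x → Q y → R (x + y)) →
  All P X → All Q Y → All R (sumset X Y)
All-sumset PQ⇒R PX QY =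
  All.deduplicate⁺ _≟_ (All.concat⁺ (All.map⁺ (All.map (λ Px → All.map⁺ (All.map (PQ⇒R Px) QY)) PX)))

All-nfold : ∀ {Q : ℕ → Set} (P : ℕ → ℕ → Set) {A} → (∀ {x} → Q x → P 1 x) →
  (∀ {k x y} → Q x → P (suc k) y → P (suc (suc k)) (x + y)) →
  All Q A → ∀ k → All (P (suc k)) (nfold (suc k) A)
All-nfold P base step QA zero = All.map base QA
All-nfold P base step QA (suc k) = All-sumset step QA (All-nfold P base step QA k)

Unique-nfold : ∀ {A} → Unique A → ∀ n → Unique (nfold n A)
Unique-nfold A-unique zero = [] ∷ []
Unique-nfold A-unique (suc zero) = A-unique
Unique-nfold A-unique (suc (suc n)) = UniqueDec.deduplicate-! _≟_ _

largest-gap : ∀ (S : ℕ → Bool) {F x} → CofiniteBound S F → S x ≡ false →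
  ∃ λ f → S f ≡ false × CofiniteBound S (suc f)
largest-gap S {zero} {x} F-bound x-gap = contradiction (F-bound x z≤n) (not-¬ x-gap)
largest-gap S {suc F} F-bound x-gap with S F in F∈S?
... | false = F , F∈S? , F-bound
... | true = largest-gap S F-bound′ x-gap
  where
  F-bound′ : CofiniteBound S F
  F-bound′ n F≤n with m≤n⇒m<n∨m≡n F≤n
  ... | inj₁ F<n = F-bound n F<n
  ... | inj₂ refl = F∈S?

∈-gapset⁺ : ∀ (S : ℕ → Bool) {F x} → CofiniteBound S F → S x ≡ false → x ∈ gapset S F
∈-gapset⁺ S {F} {x} F-bound x-gap =
  ∈-filter⁺ (λ n → T? (not (S n))) (∈-upTo⁺ (≰⇒> F≰x)) (subst (T ∘ not) (sym x-gap) _)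
  where
  F≰x : ¬ F ≤ x
  F≰x F≤x = not-¬ x-gap (F-bound x F≤x)

∈-gapset⁻ : ∀ (S : ℕ → Bool) F {x} → x ∈ gapset S F → S x ≡ false
∈-gapset⁻ S F {x} x∈G with ∈-filter⁻ (λ n → T? (not (S n))) {xs = upTo F} x∈G
... | _ , x∉S with S x
...   | false = refl

[2n∸1]h+h≡n[h+h] : ∀ k h → (2 * suc k ∸ 1) * h + h ≡ suc k * (h + h)
[2n∸1]h+h≡n[h+h] = identity
  where
  identity : ∀ k h → (k + (suc k + 0)) * h + h ≡ suc k * (h + h)
  identity = solve-∀

n[1+e]∸n≡ne : ∀ n e → n * suc e ∸ n ≡ n * e
n[1+e]∸n≡ne n e = trans (cong (_∸ n) (*-suc n e)) (m+n∸m≡n n (n * e))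

m≤n*m∸n : ∀ {m n} → 2 ≤ m → 2 ≤ n → m ≤ n * m ∸ n
m≤n*m∸n {suc e} {suc (suc k)} (s≤s 1≤e) (s≤s (s≤s _)) = begin
  suc e                               ≡⟨ +-comm 1 e ⟩
  e + 1                               ≤⟨ +-monoʳ-≤ e (≤-trans 1≤e (m≤m+n e (k * e))) ⟩
  e + (e + k * e)                     ≡⟨ n[1+e]∸n≡ne (suc (suc k)) e ⟨
  suc (suc k) * suc e ∸ suc (suc k)   ∎
  where open ≤-Reasoning

symmetric-arith : ∀ {n f g} L → 1 ≤ n → 1 ≤ f → 1 ≤ g →
  L + g ≤ suc (n * f ∸ n) → suc f ≤ g + g → L ≤ (2 * n ∸ 1) * (g ∸ 1)
symmetric-arith {suc k} {suc e} {suc h} L _ _ _ L+g≤ f<2g = +-cancelʳ-≤ h L _ (begin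
  L + h                 ≤⟨ ≤-pred (≤-trans (≤-reflexive (sym (+-suc L h))) L+g≤) ⟩
  suc k * suc e ∸ suc k ≡⟨ n[1+e]∸n≡ne (suc k) e ⟩
  suc k * e             ≤⟨ *-monoʳ-≤ (suc k) e≤2h ⟩
  suc k * (h + h)       ≡⟨ [2n∸1]h+h≡n[h+h] k h ⟨
  (2 * suc k ∸ 1) * h + h ∎)
  where
  open ≤-Reasoning
  e≤2h : e ≤ h + h
  e≤2h = ≤-pred (≤-pred (≤-trans f<2g (≤-reflexive (+-suc (suc h) h))))

asymmetric-arith : ∀ {n f g} L → 1 ≤ n → 1 ≤ f → 1 ≤ g →
  L ≤ suc (n * f ∸ n) → suc (suc f) ≤ g + g → g ≤ n → L ≤ (2 * n ∸ 1) * (g ∸ 1)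
asymmetric-arith {suc k} {suc e} {suc h} L _ _ _ L≤ f+1<2g g≤n = +-cancelʳ-≤ h L _ (begin
  L + h                  ≤⟨ +-monoˡ-≤ h L≤ ⟩
  suc (n * suc e ∸ n) + h ≡⟨ cong (λ t → suc t + h) (n[1+e]∸n≡ne n e) ⟩
  suc (n * e) + h        ≡⟨ +-suc (n * e) h ⟨
  n * e + suc h          ≤⟨ +-monoʳ-≤ (n * e) g≤n ⟩
  n * e + n              ≡⟨ trans (*-suc n e) (+-comm n (n * e)) ⟨
  n * suc e              ≤⟨ *-monoʳ-≤ n 1+e≤2h ⟩
  n * (h + h)            ≡⟨ [2n∸1]h+h≡n[h+h] k h ⟨
  (2 * n ∸ 1) * h + h    ∎)
  where
  open ≤-Reasoning
  n = suc k
  1+e≤2h : suc e ≤ h + h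
  1+e≤2h = ≤-pred (≤-pred (≤-trans f+1<2g (≤-reflexive (+-suc (suc h) h))))

module NumericalSemigroup (S : ℕ → Bool) (S-submonoid : IsSubmonoid S)
  {F : ℕ} (F-bound : CofiniteBound S F)
  {f : ℕ} (f-gap : S f ≡ false) (f-largest : CofiniteBound S (suc f)) where

  open IsSubmonoid S-submonoid

  G : List ℕ
  G = gapset S F

  g : ℕ
  g = length G

  ∈G⁺ : ∀ {x} → S x ≡ false → x ∈ G
  ∈G⁺ = ∈-gapset⁺ S F-bound

  ∈G⁻ : ∀ {x} → x ∈ G → S x ≡ false
  ∈G⁻ = ∈-gapset⁻ S F

  G-unique : Unique G
  G-unique = Unique.filter⁺ (λ n → T? (not (S n))) (Unique.upTo⁺ F)

  gap-positive : ∀ {x} → S x ≡ false → 1 ≤ x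
  gap-positive {zero} x-gap = contradiction zero∈ (not-¬ x-gap)
  gap-positive {suc x} _ = s≤s z≤n

  gap≤frobenius : ∀ {x} → S x ≡ false → x ≤ f
  gap≤frobenius {x} x-gap = ≮⇒≥ (λ f<x → not-¬ x-gap (f-largest x f<x))

  gap-range : All (λ x → 1 ≤ x × x ≤ f) G
  gap-range = All.tabulate (λ x∈G → gap-positive (∈G⁻ x∈G) , gap≤frobenius (∈G⁻ x∈G))

  genus≤frobenius : g ≤ f
  genus≤frobenius =
    ≤-pred (unique<⇒length≤ (0∉G ∷ G-unique) (z<s ∷ All.map (s≤s ∘ proj₂) gap-range))
    where
    0∉G : All (0 ≢_) G
    0∉G = All.map (λ (1≤x , _) 0≡x → <⇒≢ 1≤x 0≡x) gap-range

  -- f ∉ S, so z ≤ f cannot have both z and f − z in S.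
  gap-or-mirror-gap : ∀ {z} → z ≤ f → S z ≡ false ⊎ (S z ≡ true × S (f ∸ z) ≡ false)
  gap-or-mirror-gap {z} z≤f with S z in z∈S? | S (f ∸ z) in f∸z∈S?
  ... | false | _ = inj₁ refl
  ... | true | false = inj₂ (refl , refl)
  ... | true | true = ⊥-elim (not-¬ f-gap
          (subst (λ t → S t ≡ true) (m+[n∸m]≡n z≤f) (closed z (f ∸ z) z∈S? f∸z∈S?)))

  MirrorInS : ℕ → Set
  MirrorInS x = S (f ∸ x) ≡ true

  mirrorInS? : Decidable MirrorInS
  mirrorInS? x = S (f ∸ x) Bool.≟ true

  Symmetric : Set
  Symmetric = All MirrorInS G

  mirrored : List ℕ
  mirrored = filter mirrorInS? G

  upTo⊆G++mirror : upTo (suc f) ⊆ G ++ map (f ∸_) mirrored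
  upTo⊆G++mirror {z} z∈ with gap-or-mirror-gap (≤-pred (∈-upTo⁻ z∈))
  ... | inj₁ z-gap = ∈-++⁺ˡ (∈G⁺ z-gap)
  ... | inj₂ (z∈S , f∸z-gap) = ∈-++⁺ʳ G (subst (_∈ map (f ∸_) mirrored) f∸[f∸z]≡z
          (∈-map⁺ (f ∸_) (∈-filter⁺ mirrorInS? (∈G⁺ f∸z-gap) (trans (cong S f∸[f∸z]≡z) z∈S))))
    where
    f∸[f∸z]≡z : f ∸ (f ∸ z) ≡ z
    f∸[f∸z]≡z = m∸[m∸n]≡n (≤-pred (∈-upTo⁻ z∈))

  frobenius<genus+mirrored : suc f ≤ g + length mirrored
  frobenius<genus+mirrored = subst₂ _≤_ (length-upTo (suc f))
    (trans (length-++ G) (cong (g +_) (length-map (f ∸_) mirrored)))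
    (unique⊆⇒length≤ _≟_ (Unique.upTo⁺ (suc f)) upTo⊆G++mirror)

  nfold-range : ∀ k → All (λ y → suc k ≤ y × y ≤ suc k * f) (nfold (suc k) G)
  nfold-range = All-nfold (λ n y → n ≤ y × y ≤ n * f)
    (λ (1≤x , x≤f) → 1≤x , ≤-trans x≤f (≤-reflexive (sym (*-identityˡ f))))
    (λ (1≤x , x≤f) (n≤y , y≤nf) → +-mono-≤ 1≤x n≤y , +-mono-≤ x≤f y≤nf)
    gap-range

  ComplementInS : ℕ → ℕ → Set
  ComplementInS w y = ∃ λ z → S z ≡ true × y + z ≡ w

  nfold-mirror : Symmetric → ∀ k → All (ComplementInS (suc k * f)) (nfold (suc k) G)
  nfold-mirror symmetric = All-nfold {Q = ComplementInS f} (λ n → ComplementInS (n * f))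
    (λ (z , z∈S , x+z≡f) → z , z∈S , trans x+z≡f (sym (*-identityˡ f)))
    (λ {_} {x} {y} (z₁ , z₁∈S , x+z₁≡f) (z₂ , z₂∈S , y+z₂≡nf) →
      z₁ + z₂ , closed z₁ z₂ z₁∈S z₂∈S , trans (interchange x y z₁ z₂) (cong₂ _+_ x+z₁≡f y+z₂≡nf))
    (All.zipWith (λ {x} (f∸x∈S , (_ , x≤f)) → f ∸ x , f∸x∈S , m+[n∸m]≡n x≤f) (symmetric , gap-range))

  mirror : ℕ → List ℕ
  mirror k = map (suc k * f ∸_) (nfold (suc k) G)

  mirror-unique : ∀ k → Unique (mirror k)
  mirror-unique k =
    unique-map-∸ (suc k * f) (All.map proj₂ (nfold-range k)) (Unique-nfold G-unique (suc k))

  mirror-range : ∀ k → All (_< suc (suc k * f ∸ suc k)) (mirror k)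
  mirror-range k =
    All.map⁺ (All.map (λ (n≤y , _) → s≤s (∸-monoʳ-≤ (suc k * f) n≤y)) (nfold-range k))

  mirror-length : ∀ k → length (mirror k) ≡ length (nfold (suc k) G)
  mirror-length k = length-map (suc k * f ∸_) (nfold (suc k) G)

  nfold-length≤ : ∀ k → length (nfold (suc k) G) ≤ suc (suc k * f ∸ suc k)
  nfold-length≤ k =
    subst (_≤ _) (mirror-length k) (unique<⇒length≤ (mirror-unique k) (mirror-range k))

  symmetric-nfold-length≤ : Symmetric → ∀ k → 1 ≤ k → 2 ≤ f →
    length (nfold (suc k) G) + g ≤ suc (suc k * f ∸ suc k)
  symmetric-nfold-length≤ symmetric k 1≤k 2≤f =
    subst (_≤ _) (trans (length-++ (mirror k)) (cong (_+ g) (mirror-length k)))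
      (unique<⇒length≤ (Unique.++⁺ (mirror-unique k) G-unique mirror∩G≡∅)
        (All.++⁺ (mirror-range k)
          (All.map (λ (_ , x≤f) → s≤s (≤-trans x≤f (m≤n*m∸n 2≤f (s≤s 1≤k)))) gap-range)))
    where
    mirror∩G≡∅ : ∀ {v} → ¬ (v ∈ mirror k × v ∈ G)
    mirror∩G≡∅ (v∈mirror , v∈G) with ∈-map⁻ (suc k * f ∸_) v∈mirror
    ... | y , y∈nG , refl with All.lookup (nfold-mirror symmetric k) y∈nG
    ...   | z , z∈S , y+z≡nf =
      not-¬ (∈G⁻ v∈G)
        (subst (λ t → S t ≡ true) (trans (sym (m+n∸m≡n y z)) (cong (_∸ y) y+z≡nf)) z∈S)

  frobenius<2genus : suc f ≤ g + g
  frobenius<2genus = ≤-trans frobenius<genus+mirrored (+-monoʳ-≤ g (length-filter mirrorInS? G))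

  asymmetric⇒frobenius+1<2genus : ¬ Symmetric → suc (suc f) ≤ g + g
  asymmetric⇒frobenius+1<2genus asymmetric = begin
    suc (suc f)               ≤⟨ s≤s frobenius<genus+mirrored ⟩
    suc (g + length mirrored) ≡⟨ +-suc g _ ⟨
    g + suc (length mirrored) ≤⟨ +-monoʳ-≤ g (filter-notAll mirrorInS? G some-mirror-gap) ⟩
    g + g                     ∎
    where
    open ≤-Reasoning
    some-mirror-gap = All.¬All⇒Any¬ mirrorInS? G asymmetric

  buchweitz-bound : 2 ≤ g → ∀ k → 2 ≤ suc k → g ≤ suc k →
    length (nfold (suc k) G) ≤ (2 * suc k ∸ 1) * (g ∸ 1)
  buchweitz-bound 2≤g k (s≤s 1≤k) g≤n with all? mirrorInS? G
  ... | yes symmetric = symmetric-arith _ (s≤s z≤n) (gap-positive f-gap) (≤-trans (n≤1+n 1) 2≤g)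
          (symmetric-nfold-length≤ symmetric k 1≤k (≤-trans 2≤g genus≤frobenius)) frobenius<2genus
  ... | no asymmetric = asymmetric-arith _ (s≤s z≤n) (gap-positive f-gap) (≤-trans (n≤1+n 1) 2≤g)
          (nfold-length≤ k) (asymmetric⇒frobenius+1<2genus asymmetric) g≤n

theorem3p3 : (S : ℕ → Bool) → IsSubmonoid S → (F : ℕ) → CofiniteBound S F →
    2 ≤ length (gapset S F) → FiniteSet (InBuchweitz (gapset S F))
theorem3p3 S S-submonoid F F-bound 2≤g = length (gapset S F) , outside-B
  where
  some-gap : ∃ (_∈ gapset S F)
  some-gap = first-∈ (≤-trans (n≤1+n 1) 2≤g)

  frobenius : ∃ λ f → S f ≡ false × CofiniteBound S (suc f)
  frobenius = largest-gap S F-bound (∈-gapset⁻ S F (proj₂ some-gap))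

  open NumericalSemigroup S S-submonoid F-bound (proj₁ (proj₂ frobenius)) (proj₂ (proj₂ frobenius))

  outside-B : ∀ n → g ≤ n → ¬ InBuchweitz G n
  outside-B zero _ (() , _)
  outside-B (suc k) g≤n (2≤n , bound<|nG|) = <⇒≱ bound<|nG| (buchweitz-bound 2≤g k 2≤n g≤n)
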